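{- Let $M$ and $N$ be matroids with common ground set $E$. The following are equivalent: (1) $N\preceq M$; (2) $M^*\preceq N^*$; (3) $\mathrm{cl}_M(X)\subseteq\mathrm{cl}_N(X)$ for all $X\subseteq E$; (4) $\mathrm{cl}_M(I)\subseteq\mathrm{cl}_N(I)$ for every independent set $I$ of $M$; (5) every flat of $N$ is a flat of $M$; (6) every circuit of $M$ is a union of circuits of $N$; (7) $r_{N/X}(Y-X)\le r_{M/X}(Y-X)$ for all $X\subseteq Y\subseteq E$.
   Context: Matroids are possibly infinite (in the sense of Bruhn, Diestel, Kriesell, Pendavingh and Wollan), with the usual notions of independence, bases, circuits, closure, flats, duality, deletion and contraction. Ranks take values in $\mathbb{N}\cup\{\infty\}$: the rank of a matroid is the number of elements of any basis, viewed in $\mathbb{N}\cup\{\infty\}$. For matroids $M,N$ on the same ground set $E$, $N$ is a quotient of $M$, written $N\preceq M$, if $\mathrm{cl}_M(X)\subseteq\mathrm{cl}_N(X)$ for all $X\subseteq E$. -}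

module Defs where

open import Level using (0ℓ) renaming (suc to lsuc)
open import Data.Nat using (ℕ; _≤_)
open import Data.Product using (Σ; ∃; ∃-syntax; _×_; _,_)
open import Data.List using (List; length)
open import Data.List.Membership.Propositional using () renaming (_∈_ to _∈ₗ_)
open import Data.List.Relation.Unary.Unique.Propositional using (Unique)
open import Relation.Binary.PropositionalEquality using (_≡_)
open import Relation.Nullary using (¬_)
open import Relation.Unary using (Pred; _⊆_; _≐_; _∪_; _∩_; ∁; ∅; ｛_｝; _∈_; _∉_)
open import Function.Bundles using (_⇔_)

Subset : Set → Set₁
Subset E = Pred E 0ℓ

IndPred : Set → Set₂
IndPred E = Subset E → Set₁

module _ {E : Set} where

  Maximal : (Subset E → Set₁) → Subset E → Set₁
  Maximal P J = P J × (∀ J' → P J' → J ⊆ J' → J' ⊆ J)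

  _⊊_ : Subset E → Subset E → Set
  A ⊊ B = A ⊆ B × ¬ (B ⊆ A)

  _－_ : Subset E → Subset E → Subset E
  A － B = A ∩ ∁ B

  Base : IndPred E → Subset E → Set₁
  Base Ind = Maximal Ind

  BasisOf : IndPred E → Subset E → Subset E → Set₁
  BasisOf Ind A = Maximal (λ J → Ind J × J ⊆ A)

  Circuit : IndPred E → Subset E → Set₁
  Circuit Ind C = ¬ Ind C × (∀ D → D ⊊ C → Ind D)

  cl : IndPred E → Subset E → Pred E (lsuc 0ℓ)
  cl Ind X x = X x Data.Sum.⊎ ∃[ C ] (Circuit Ind C × C x × C ⊆ (X ∪ ｛ x ｝))
    where import Data.Sum

  Flat : IndPred E → Subset E → Set₁
  Flat Ind F = cl Ind F ⊆ F

  dual : IndPred E → IndPred E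
  dual Ind I = ∃[ B ] (Base Ind B × I ⊆ ∁ B)

  -- contraction M/X, with ground set E - X (still represented inside E):
  -- I is independent iff I ⊆ E - X and I ∪ J is independent for a basis J of X
  contract : IndPred E → Subset E → IndPred E
  contract Ind X I = I ⊆ ∁ X × ∃[ J ] (BasisOf Ind X J × Ind (I ∪ J))

  _≼_ : IndPred E → IndPred E → Set₁
  N ≼ M = ∀ X → cl M X ⊆ cl N X

  ⋃ : (Subset E → Set₁) → Pred E (lsuc 0ℓ)
  ⋃ 𝒟 x = ∃[ D ] (𝒟 D × D x)

data ℕ∞ : Set where
  fin : ℕ → ℕ∞
  ∞   : ℕ∞

data _≤∞_ : ℕ∞ → ℕ∞ → Set where
  fin≤fin : ∀ {m n} → m ≤ n → fin m ≤∞ fin n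
  _≤∞∞    : ∀ k → k ≤∞ ∞

module _ {E : Set} where

  SizeOf : Subset E → ℕ∞ → Set
  SizeOf A (fin n) = ∃[ xs ] (Unique xs × length xs ≡ n × (∀ x → (x ∈ A) ⇔ (x ∈ₗ xs)))
  SizeOf A ∞ = ¬ (∃[ n ] SizeOf A (fin n))

  -- r(A) = k : some basis of A has k elements (all bases of A have the same size)
  HasRank : IndPred E → Subset E → ℕ∞ → Set₁
  HasRank Ind A k = ∃[ B ] (BasisOf Ind A B × SizeOf B k)

-- Matroids (possibly infinite) on ground set E, via the independence axioms
-- of Bruhn–Diestel–Kriesell–Pendavingh–Wollan.
record Matroid (E : Set) : Set₂ where
  field
    Ind : IndPred E
    I1  : Ind ∅
    I2  : ∀ I J → J ⊆ I → Ind I → Ind J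
    I3  : ∀ I B → Ind I → ¬ Maximal Ind I → Maximal Ind B →
          ∃[ x ] (x ∈ B × x ∉ I × Ind (I ∪ ｛ x ｝))
    IM  : ∀ I (X : Subset E) → Ind I → I ⊆ X →
          ∃[ J ] Maximal (λ J′ → Ind J′ × I ⊆ J′ × J′ ⊆ X) J

{-# OPTIONS --safe #-}
-- Everything is reduced to (3), i.e. to closures. For e ∉ X one has e ∈ cl*(X) iff
-- e ∉ cl(E − X − e): one direction uses the fundamental cocircuit of a base through e, the other
-- that a circuit and a cocircuit never meet in exactly one element; this turns (2) into (1).
-- (4) and (5) follow because cl(X) = cl(I) for a basis I of X and cl(I) is a flat. For (6), each
-- e ∈ C lies in cl_M(C − e), hence in an N-circuit inside C. For (7), a basis of Y − X in M/X
-- together with a basis of X spans Y in M, hence in N, and Steinitz exchange bounds the rank in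
-- N/X; conversely an e ∈ cl_M(X) − cl_N(X) has rank 1 in N/X but rank 0 in M/X.
module Submission where

open import Defs
open import Level using (Level)
open import Axiom.ExcludedMiddle using (ExcludedMiddle)
open import Axiom.DoubleNegationElimination using (em⇒dne)
open import Data.Product using (_×_; _,_; proj₁; proj₂; ∃-syntax)
open import Data.Sum using (inj₁; inj₂)
open import Data.Empty using (⊥; ⊥-elim)
open import Data.Nat using (ℕ; zero; suc; z≤n; s≤s) renaming (_≤_ to _≤ℕ_)
open import Data.Nat.Properties using (1+n≰n)
open import Data.List using ([]; _∷_; length)
open import Data.List.Membership.Propositional using () renaming (_∈_ to _∈ₗ_)
open import Data.List.Relation.Unary.Any using (here; there)
open import Data.List.Relation.Unary.All as All using (All; []; _∷_)
open import Data.List.Relation.Unary.All.Properties.Core using (¬Any⇒All¬)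
open import Data.List.Relation.Unary.AllPairs using ([]; _∷_)
open import Data.List.Relation.Unary.Unique.Propositional using (Unique)
open import Relation.Binary.PropositionalEquality using (_≡_; refl; sym; subst; cong)
open import Relation.Nullary using (¬_; Dec; yes; no)
open import Relation.Nullary.Decidable using (True; toWitness; fromWitness)
open import Relation.Unary using (Pred; _⊆_; _≐_; _∪_; _∩_; ∁; ∅; U; ｛_｝)
open import Function.Base using (id)
open import Function.Bundles using (_⇔_; mk⇔; module Equivalence)
open Matroid using (Ind)

module _ {E : Set} where

  private variable
    ℓ₁ ℓ₂ : Level
    e x : E

  insert-mono : {A : Pred E ℓ₁} {B : Pred E ℓ₂} → A ⊆ B → A ∪ ｛ x ｝ ⊆ B ∪ ｛ x ｝
  insert-mono A⊆B (inj₁ a) = inj₁ (A⊆B a)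
  insert-mono A⊆B (inj₂ x≡z) = inj₂ x≡z

  insert-⊆ : {A : Pred E ℓ₁} {B : Pred E ℓ₂} → A ⊆ B → B x → A ∪ ｛ x ｝ ⊆ B
  insert-⊆ A⊆B Bx (inj₁ a) = A⊆B a
  insert-⊆ A⊆B Bx (inj₂ refl) = Bx

  insert-comm : {A : Pred E ℓ₁} → (A ∪ ｛ x ｝) ∪ ｛ e ｝ ⊆ (A ∪ ｛ e ｝) ∪ ｛ x ｝
  insert-comm (inj₁ (inj₁ a)) = inj₁ (inj₁ a)
  insert-comm (inj₁ (inj₂ x≡z)) = inj₂ x≡z
  insert-comm (inj₂ e≡z) = inj₁ (inj₂ e≡z)

  size-∅ : SizeOf {E} ∅ (fin 0)
  size-∅ = [] , [] , refl , λ _ → mk⇔ (λ ()) (λ ())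

  size-｛｝ : SizeOf ｛ e ｝ (fin 1)
  size-｛｝ {e} = e ∷ [] , [] ∷ [] , refl , λ _ → mk⇔ (λ { refl → here refl }) λ { (here refl) → refl }

module Classical (em : ∀ {ℓ} → ExcludedMiddle ℓ) where

  decide : ∀ {ℓ} (P : Set ℓ) → Dec P
  decide P = em

  ¬¬-elim : ∀ {ℓ} {P : Set ℓ} → ¬ ¬ P → P
  ¬¬-elim = em⇒dne em

  ¬⊆⇒∃∉ : ∀ {a ℓ₁ ℓ₂} {A : Set a} {P : Pred A ℓ₁} {Q : Pred A ℓ₂} →
          ¬ P ⊆ Q → ∃[ x ] (P x × ¬ Q x)
  ¬⊆⇒∃∉ P⊈Q = ¬¬-elim λ ∄ → P⊈Q λ {x} Px → ¬¬-elim λ ¬Qx → ∄ (x , Px , ¬Qx)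

  -- Under excluded middle every proposition is equivalent to one in Set; this is what lets
  -- Set₁-valued predicates such as cl(I) be used as subsets of the ground set.
  Small : ∀ {ℓ} → Set ℓ → Set
  Small P = True (decide P)

  small : ∀ {ℓ} {P : Set ℓ} → P → Small P
  small = fromWitness

  unsmall : ∀ {ℓ} {P : Set ℓ} → Small P → P
  unsmall = toWitness

  module _ {E : Set} where

    ∁-∁-insert : {X : Subset E} {e : E} → ¬ X e → X ≐ ∁ (∁ (X ∪ ｛ e ｝) ∪ ｛ e ｝)
    ∁-∁-insert {X} {e} ¬Xe = X⊆ , ⊆X
      where
      X⊆ : X ⊆ ∁ (∁ (X ∪ ｛ e ｝) ∪ ｛ e ｝)
      X⊆ Xz (inj₁ ¬Xz) = ¬Xz (inj₁ Xz)
      X⊆ Xz (inj₂ refl) = ¬Xe Xz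
      ⊆X : ∁ (∁ (X ∪ ｛ e ｝) ∪ ｛ e ｝) ⊆ X
      ⊆X ¬z = ¬¬-elim λ ¬Xz → ¬z (inj₁ λ { (inj₁ Xz) → ¬Xz Xz ; (inj₂ e≡z) → ¬z (inj₂ e≡z) })

    unique-lists-in-infinite : {A : Subset E} → SizeOf A ∞ →
                               ∀ n → ∃[ xs ] (Unique xs × length xs ≡ n × All A xs)
    unique-lists-in-infinite A-inf zero = [] , [] , refl , []
    unique-lists-in-infinite {A} A-inf (suc n) with unique-lists-in-infinite A-inf n
    ... | xs , uxs , |xs|≡n , Axs with decide (∃[ z ] (A z × ¬ z ∈ₗ xs))
    ...   | yes (z , Az , z∉xs) = z ∷ xs , ¬Any⇒All¬ xs z∉xs ∷ uxs , cong suc |xs|≡n , Az ∷ Axs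
    ...   | no ∄ = ⊥-elim (A-inf (n , xs , uxs , |xs|≡n , λ z → mk⇔ (A⊆xs z) (All.lookup Axs)))
      where
      A⊆xs : ∀ z → A z → z ∈ₗ xs
      A⊆xs z Az = ¬¬-elim λ z∉xs → ∄ (z , Az , z∉xs)

    size-≤-fin : {A : Subset E} {k : ℕ∞} {n : ℕ} → SizeOf A k →
                 (∀ xs → Unique xs → All A xs → length xs ≤ℕ n) → k ≤∞ fin n
    size-≤-fin {k = fin m} {n} (xs , uxs , |xs|≡m , A⇔xs) bound =
      fin≤fin (subst (_≤ℕ n) |xs|≡m (bound xs uxs (All.tabulate λ {z} → Equivalence.from (A⇔xs z))))
    size-≤-fin {k = ∞} {n} A-inf bound with unique-lists-in-infinite A-inf (suc n)
    ... | xs , uxs , |xs|≡1+n , Axs = ⊥-elim (1+n≰n (subst (_≤ℕ n) |xs|≡1+n (bound xs uxs Axs)))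

module MatroidProperties (em : ∀ {ℓ} → ExcludedMiddle ℓ) {E : Set} (M : Matroid E) where
  open Classical em
  open Matroid M using (I1; I2; I3; IM) renaming (Ind to Indep)

  private variable
    A B I J K X Y : Subset E
    e x y : E

  Indep-⊆ : J ⊆ I → Indep I → Indep J
  Indep-⊆ {J} {I} J⊆I = I2 I J J⊆I

  cl-mono : A ⊆ B → cl Indep A ⊆ cl Indep B
  cl-mono A⊆B (inj₁ a) = inj₁ (A⊆B a)
  cl-mono {A} A⊆B (inj₂ (C , circuit , Cx , C⊆)) = inj₂ (C , circuit , Cx , λ c → insert-mono {A = A} A⊆B (C⊆ c))

  basis-⊇ : Indep I → I ⊆ X → ∃[ K ] (BasisOf Indep X K × I ⊆ K)
  basis-⊇ {I} {X} iI I⊆X with IM I X iI I⊆X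
  ... | K , (iK , I⊆K , K⊆X) , maximal =
    K , ((iK , K⊆X) , λ J (iJ , J⊆X) K⊆J → maximal J (iJ , (λ i → K⊆J (I⊆K i)) , J⊆X) K⊆J) , I⊆K

  basis-exists : ∀ X → ∃[ K ] BasisOf Indep X K
  basis-exists X with basis-⊇ I1 (λ {_} ())
  ... | K , basis , _ = K , basis

  base-⊇ : Indep I → ∃[ B ] (Base Indep B × I ⊆ B)
  base-⊇ iI with basis-⊇ {X = U} iI _
  ... | B , ((iB , _) , maximal) , I⊆B = B , (iB , λ J iJ B⊆J → maximal J (iJ , _) B⊆J) , I⊆B

  basis-maximal : BasisOf Indep X I → X x → ¬ I x → ¬ Indep (I ∪ ｛ x ｝)
  basis-maximal ((_ , I⊆X) , maximal) Xx ¬Ix iIx = ¬Ix (maximal _ (iIx , insert-⊆ I⊆X Xx) inj₁ (inj₂ refl))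

  base-maximal : Base Indep B → ¬ B x → ¬ Indep (B ∪ ｛ x ｝)
  base-maximal (_ , maximal) ¬Bx iBx = ¬Bx (maximal _ iBx inj₁ (inj₂ refl))

  basis-insert : BasisOf Indep X I → Indep (I ∪ ｛ x ｝) → BasisOf Indep (X ∪ ｛ x ｝) (I ∪ ｛ x ｝)
  basis-insert {X} {I} {x} ((_ , I⊆X) , maximal) iIx = (iIx , insert-mono {A = I} I⊆X) , grow
    where
    grow : ∀ J → Indep J × J ⊆ X ∪ ｛ x ｝ → I ∪ ｛ x ｝ ⊆ J → J ⊆ I ∪ ｛ x ｝
    grow J (iJ , J⊆) Ix⊆J Jz with J⊆ Jz
    ... | inj₂ x≡z = inj₂ x≡z
    ... | inj₁ Xz = inj₁ (maximal (J ∩ X) (Indep-⊆ proj₁ iJ , proj₂) (λ {z} i → Ix⊆J (inj₁ i) , I⊆X i) (Jz , Xz))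

  basis-∩ : BasisOf Indep X B → Indep K → B ⊆ K → K ∩ X ⊆ B
  basis-∩ {X} {K = K} ((_ , B⊆X) , maximal) iK B⊆K =
    maximal (K ∩ X) (Indep-⊆ proj₁ iK , proj₂) (λ b → B⊆K b , B⊆X b)

  augment-through-base : {B′ I′ : Subset E} → BasisOf Indep X B → Base Indep B′ → B ⊆ B′ →
                         I ⊆ X → X y → ¬ I y →
                         Base Indep I′ → I ∪ ｛ y ｝ ⊆ I′ → I′ ⊆ (I ∪ ｛ y ｝) ∪ (B′ － X) →
                         ∃[ x ] (B x × ¬ I x × Indep (I ∪ ｛ x ｝))
  augment-through-base {X} {B} {I} {y} {B′} {I′}
    basisB (iB′ , _) B⊆B′ I⊆X Xy ¬Iy baseI′@(iI′ , _) Iy⊆I′ I′⊆ =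
    augment-from-I3 (I3 T B″ iT ¬baseT baseB″)
    where
    S T B″ : Subset E
    S = I′ － X
    T = I ∪ S
    B″ = B ∪ S
    S⊆B′ : S ⊆ B′
    S⊆B′ (I′z , ¬Xz) with I′⊆ I′z
    ... | inj₁ (inj₁ Iz) = ⊥-elim (¬Xz (I⊆X Iz))
    ... | inj₁ (inj₂ refl) = ⊥-elim (¬Xz Xy)
    ... | inj₂ (B′z , _) = B′z
    iB″ : Indep B″
    iB″ = Indep-⊆ (λ { (inj₁ b) → B⊆B′ b ; (inj₂ s) → S⊆B′ s }) iB′
    T⊆I′ : T ⊆ I′
    T⊆I′ (inj₁ Iz) = Iy⊆I′ (inj₁ Iz)
    T⊆I′ (inj₂ (I′z , _)) = I′z
    iT : Indep T
    iT = Indep-⊆ T⊆I′ iI′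
    ¬baseT : ¬ Base Indep T
    ¬baseT (_ , maximal) with maximal I′ iI′ T⊆I′ (Iy⊆I′ (inj₂ refl))
    ... | inj₁ Iy = ¬Iy Iy
    ... | inj₂ (_ , ¬Xy) = ¬Xy Xy
    baseB″ : Base Indep B″
    baseB″ = ¬¬-elim λ ¬baseB″ → extend-B (I3 B″ I′ iB″ ¬baseB″ baseI′)
      where
      extend-B : ∃[ w ] (I′ w × ¬ B″ w × Indep (B″ ∪ ｛ w ｝)) → ⊥
      extend-B (w , I′w , ¬B″w , iB″w) with decide (X w)
      ... | yes Xw = basis-maximal basisB Xw (λ Bw → ¬B″w (inj₁ Bw)) (Indep-⊆ (insert-mono {A = B} {B = B″} inj₁) iB″w)
      ... | no ¬Xw = ¬B″w (inj₂ (I′w , ¬Xw))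
    augment-from-I3 : ∃[ x ] (B″ x × ¬ T x × Indep (T ∪ ｛ x ｝)) →
                      ∃[ x ] (B x × ¬ I x × Indep (I ∪ ｛ x ｝))
    augment-from-I3 (x , inj₁ Bx , ¬Tx , iTx) =
      x , Bx , (λ Ix → ¬Tx (inj₁ Ix)) , Indep-⊆ (insert-mono {A = I} {B = T} inj₁) iTx
    augment-from-I3 (x , inj₂ Sx , ¬Tx , _) = ⊥-elim (¬Tx (inj₂ Sx))

  -- I3 only compares with bases of the whole matroid, so B is extended to a base B′ and I + y to
  -- a maximal independent I′ ⊆ (I + y) ∪ (B′ − X). If I′ is not a base, I3 applies to I′ and B′;
  -- otherwise it applies to I ∪ (I′ − X) and the base B ∪ (I′ − X).
  basis-augment : BasisOf Indep X B → I ⊆ X → X y → ¬ I y → Indep (I ∪ ｛ y ｝) →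
                  ∃[ x ] (B x × ¬ I x × Indep (I ∪ ｛ x ｝))
  basis-augment {X} {B} {I} {y} basisB@((iB , _) , _) I⊆X Xy ¬Iy iIy with base-⊇ iB
  ... | B′ , baseB′@(iB′ , _) , B⊆B′ with basis-⊇ {X = (I ∪ ｛ y ｝) ∪ (B′ － X)} iIy inj₁
  ... | I′ , basisI′@((iI′ , I′⊆) , _) , Iy⊆I′ with decide (Base Indep I′)
  ... | yes baseI′ = augment-through-base basisB baseB′ B⊆B′ I⊆X Xy ¬Iy baseI′ Iy⊆I′ I′⊆
  ... | no ¬baseI′ = augment-from-I3 (I3 I′ B′ iI′ ¬baseI′ baseB′)
    where
    augment-from-I3 : ∃[ x ] (B′ x × ¬ I′ x × Indep (I′ ∪ ｛ x ｝)) →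
                      ∃[ x ] (B x × ¬ I x × Indep (I ∪ ｛ x ｝))
    augment-from-I3 (x , B′x , ¬I′x , iI′x) with decide (X x)
    ... | yes Xx = x , basis-∩ basisB iB′ B⊆B′ (B′x , Xx) , (λ Ix → ¬I′x (Iy⊆I′ (inj₁ Ix))) ,
                   Indep-⊆ (insert-mono {A = I} (λ Iz → Iy⊆I′ (inj₁ Iz))) iI′x
    ... | no ¬Xx = ⊥-elim (basis-maximal basisI′ (inj₂ (B′x , ¬Xx)) ¬I′x iI′x)

  basis-of-insert-⊇ : Indep I → BasisOf Indep (I ∪ ｛ e ｝) K → I x → ¬ K x → I － ｛ x ｝ ⊆ K
  basis-of-insert-⊇ {I} {e} {K} {x} iI basisK@((_ , K⊆) , _) Ix ¬Kx {w} (Iw , x≢w) =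
    ¬¬-elim λ ¬Kw → exchange-e (basis-augment basisK (λ k → inj₁ (K′⊆I k)) (inj₁ Iw)
                                  (¬K′w ¬Kw) (Indep-⊆ (insert-⊆ K′⊆I Iw) iI))
    where
    K′ : Subset E
    K′ = (K － ｛ e ｝) ∪ ｛ x ｝
    K′⊆I : K′ ⊆ I
    K′⊆I (inj₂ refl) = Ix
    K′⊆I (inj₁ (Kz , e≢z)) with K⊆ Kz
    ... | inj₁ Iz = Iz
    ... | inj₂ e≡z = ⊥-elim (e≢z e≡z)
    ¬K′w : ¬ K w → ¬ K′ w
    ¬K′w ¬Kw (inj₁ (Kw , _)) = ¬Kw Kw
    ¬K′w ¬Kw (inj₂ x≡w) = x≢w x≡w
    K∪x⊆K′∪e : K ∪ ｛ x ｝ ⊆ K′ ∪ ｛ e ｝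
    K∪x⊆K′∪e (inj₂ refl) = inj₁ (inj₂ refl)
    K∪x⊆K′∪e {z} (inj₁ Kz) with decide (e ≡ z)
    ... | yes e≡z = inj₂ e≡z
    ... | no e≢z = inj₁ (inj₁ (Kz , e≢z))
    exchange-e : ∃[ z ] (K z × ¬ K′ z × Indep (K′ ∪ ｛ z ｝)) → ⊥
    exchange-e (z , Kz , ¬K′z , iK′z) with decide (e ≡ z)
    ... | no e≢z = ¬K′z (inj₁ (Kz , e≢z))
    ... | yes refl = basis-maximal basisK (inj₁ Ix) ¬Kx (Indep-⊆ K∪x⊆K′∪e iK′z)

  fundamental-circuit : Indep I → ¬ I e → ¬ Indep (I ∪ ｛ e ｝) →
                        ∃[ C ] (Circuit Indep C × C e × C ⊆ I ∪ ｛ e ｝)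
  fundamental-circuit {I} {e} iI ¬Ie dep = C , (dependent , minimal) , inj₁ refl , C⊆
    where
    C : Subset E
    C = ｛ e ｝ ∪ λ z → I z × Small (Indep ((I － ｛ z ｝) ∪ ｛ e ｝))
    C⊆ : C ⊆ I ∪ ｛ e ｝
    C⊆ (inj₁ e≡z) = inj₂ e≡z
    C⊆ (inj₂ (Iz , _)) = inj₁ Iz
    dependent : ¬ Indep C
    dependent iC with basis-⊇ iC C⊆
    ... | K , basisK@((iK , _) , _) , C⊆K
      with ¬⊆⇒∃∉ {Q = K} (λ I∪e⊆K → dep (Indep-⊆ I∪e⊆K iK))
    ... | x , inj₂ refl , ¬Kx = ¬Kx (C⊆K (inj₁ refl))
    ... | x , inj₁ Ix , ¬Kx = ¬Kx (C⊆K (inj₂ (Ix , small (Indep-⊆ I-x+e⊆K iK))))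
      where
      I-x+e⊆K : (I － ｛ x ｝) ∪ ｛ e ｝ ⊆ K
      I-x+e⊆K = insert-⊆ (basis-of-insert-⊇ iI basisK Ix ¬Kx) (C⊆K (inj₁ refl))
    minimal : ∀ D → D ⊊ C → Indep D
    minimal D (D⊆C , C⊈D) with ¬⊆⇒∃∉ C⊈D
    ... | y , inj₁ refl , ¬Dy = Indep-⊆ D⊆I iI
      where
      D⊆I : D ⊆ I
      D⊆I Dz with D⊆C Dz
      ... | inj₁ refl = ⊥-elim (¬Dy Dz)
      ... | inj₂ (Iz , _) = Iz
    ... | y , inj₂ (_ , iI-y+e) , ¬Dy = Indep-⊆ D⊆I-y+e (unsmall iI-y+e)
      where
      D⊆I-y+e : D ⊆ (I － ｛ y ｝) ∪ ｛ e ｝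
      D⊆I-y+e Dz with D⊆C Dz
      ... | inj₁ e≡z = inj₂ e≡z
      ... | inj₂ (Iz , _) = inj₁ (Iz , λ { refl → ¬Dy Dz })

  dependent⇒∈cl : Indep I → ¬ Indep (I ∪ ｛ e ｝) → cl Indep I e
  dependent⇒∈cl {I} {e} iI dep with decide (I e)
  ... | yes Ie = inj₁ Ie
  ... | no ¬Ie = inj₂ (fundamental-circuit iI ¬Ie dep)

  ∈cl⇒dependent : ¬ I e → cl Indep I e → ¬ Indep (I ∪ ｛ e ｝)
  ∈cl⇒dependent ¬Ie (inj₁ Ie) = ⊥-elim (¬Ie Ie)
  ∈cl⇒dependent ¬Ie (inj₂ (C , (¬iC , _) , _ , C⊆)) iIe = ¬iC (Indep-⊆ C⊆ iIe)

  ∉cl⇒independent : Indep I → ¬ cl Indep I e → Indep (I ∪ ｛ e ｝)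
  ∉cl⇒independent iI e∉cl = ¬¬-elim λ dep → e∉cl (dependent⇒∈cl iI dep)

  basis-insert-circuit : {C : Subset E} → BasisOf Indep X K → Circuit Indep C → C e → C － ｛ e ｝ ⊆ K →
                         BasisOf Indep (X ∪ ｛ e ｝) K
  basis-insert-circuit {X} {K} {e} {C} ((iK , K⊆X) , maximal) (¬iC , _) Ce C-e⊆K =
    (iK , λ k → inj₁ (K⊆X k)) , grow
    where
    grow : ∀ J → Indep J × J ⊆ X ∪ ｛ e ｝ → K ⊆ J → J ⊆ K
    grow J (iJ , J⊆) K⊆J = maximal J (iJ , J⊆X) K⊆J
      where
      ¬Je : ¬ J e
      ¬Je Je = ¬iC (Indep-⊆ C⊆J iJ)
        where
        C⊆J : C ⊆ J
        C⊆J {z} Cz with decide (e ≡ z)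
        ... | yes refl = Je
        ... | no e≢z = K⊆J (C-e⊆K (Cz , e≢z))
      J⊆X : J ⊆ X
      J⊆X Jz with J⊆ Jz
      ... | inj₁ Xz = Xz
      ... | inj₂ refl = ⊥-elim (¬Je Jz)

  basis-cl : BasisOf Indep X I → cl Indep X ⊆ cl Indep I
  basis-cl {X} {I} basisI@((iI , I⊆X) , _) {e} e∈clX with decide (I e)
  ... | yes Ie = inj₁ Ie
  ... | no ¬Ie = ¬¬-elim λ e∉clI → excluded (∉cl⇒independent iI e∉clI) e∈clX
    where
    excluded : Indep (I ∪ ｛ e ｝) → ¬ cl Indep X e
    excluded iIe (inj₁ Xe) = basis-maximal basisI Xe ¬Ie iIe
    excluded iIe (inj₂ (C , circuitC@(_ , minimal) , Ce , C⊆)) with basis-⊇ iC-e C-e⊆X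
      where
      C-e⊆X : C － ｛ e ｝ ⊆ X
      C-e⊆X (Cz , e≢z) with C⊆ Cz
      ... | inj₁ Xz = Xz
      ... | inj₂ e≡z = ⊥-elim (e≢z e≡z)
      iC-e : Indep (C － ｛ e ｝)
      iC-e = minimal (C － ｛ e ｝) (proj₁ , λ C⊆C-e → proj₂ (C⊆C-e Ce) refl)
    ... | L , basisL@((_ , L⊆X) , _) , C-e⊆L
      with basis-augment (basis-insert-circuit basisL circuitC Ce C-e⊆L) (λ i → inj₁ (I⊆X i)) (inj₂ refl) ¬Ie iIe
    ... | x , Lx , ¬Ix , iIx = basis-maximal basisI (L⊆X Lx) ¬Ix iIx

  basis-spans : BasisOf Indep X I → X ⊆ cl Indep I
  basis-spans basisI Xz = basis-cl basisI (inj₁ Xz)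

  clˢ : Subset E → Subset E
  clˢ A z = Small (cl Indep A z)

  basis-clˢ : Indep I → BasisOf Indep (clˢ I) I
  basis-clˢ {I} iI = (iI , λ Iz → small (inj₁ Iz)) , grow
    where
    grow : ∀ J → Indep J × J ⊆ clˢ I → I ⊆ J → J ⊆ I
    grow J (iJ , J⊆) I⊆J Jz = ¬¬-elim λ ¬Iz → ∈cl⇒dependent ¬Iz (unsmall (J⊆ Jz)) (Indep-⊆ (insert-⊆ I⊆J Jz) iJ)

  cl-⊆-cl : A ⊆ cl Indep B → cl Indep A ⊆ cl Indep B
  cl-⊆-cl {A} {B} A⊆clB with basis-exists B
  ... | I , basisI@((iI , I⊆B) , _) =
    λ z∈clA → cl-mono I⊆B (basis-cl (basis-clˢ iI) (cl-mono A⊆clˢI z∈clA))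
    where
    A⊆clˢI : A ⊆ clˢ I
    A⊆clˢI Az = small (basis-cl basisI (A⊆clB Az))

  clˢ-flat : Flat Indep (clˢ A)
  clˢ-flat z∈cl = small (cl-⊆-cl unsmall z∈cl)

  cl-exchange : cl Indep (A ∪ ｛ y ｝) x → ¬ cl Indep A x → cl Indep (A ∪ ｛ x ｝) y
  cl-exchange {A} {y} {x} x∈clAy x∉clA with decide (x ≡ y) | decide (cl Indep A y) | basis-exists A
  ... | yes x≡y | _ | _ = inj₁ (inj₂ x≡y)
  ... | no _ | yes y∈clA | _ = ⊥-elim (x∉clA (cl-⊆-cl (insert-⊆ inj₁ y∈clA) x∈clAy))
  ... | no x≢y | no y∉clA | I , basisI@((iI , I⊆A) , _)
    with decide (Indep ((I ∪ ｛ y ｝) ∪ ｛ x ｝))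
  ... | yes iIyx = ⊥-elim (∈cl⇒dependent x∉I∪y (basis-cl (basis-insert basisI iIy) x∈clAy) iIyx)
    where
    iIy : Indep (I ∪ ｛ y ｝)
    iIy = ∉cl⇒independent iI (λ y∈clI → y∉clA (cl-mono I⊆A y∈clI))
    x∉I∪y : ¬ (I ∪ ｛ y ｝) x
    x∉I∪y (inj₁ Ix) = x∉clA (inj₁ (I⊆A Ix))
    x∉I∪y (inj₂ refl) = x≢y refl
  ... | no dep = cl-mono (insert-mono {A = I} I⊆A) (dependent⇒∈cl iIx (λ iIxy → dep (Indep-⊆ (insert-comm {A = I}) iIxy)))
    where
    iIx : Indep (I ∪ ｛ x ｝)
    iIx = ∉cl⇒independent iI (λ x∈clI → x∉clA (cl-mono I⊆A x∈clI))

  exchange-into-list : ∀ F → ¬ cl Indep A x → cl Indep (A ∪ (_∈ₗ F)) x →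
    ∃[ F′ ] (length F ≡ suc (length F′) × A ∪ (_∈ₗ F) ⊆ cl Indep ((A ∪ ｛ x ｝) ∪ (_∈ₗ F′)))
  exchange-into-list {A} [] x∉clA x∈cl = ⊥-elim (x∉clA (cl-mono A∪[]⊆A x∈cl))
    where
    A∪[]⊆A : A ∪ (_∈ₗ []) ⊆ A
    A∪[]⊆A (inj₁ Az) = Az
  exchange-into-list {A} {x} (f ∷ G) x∉clA x∈cl with decide (cl Indep (A ∪ (_∈ₗ G)) x)
  ... | yes x∈clAG = keep-f (exchange-into-list G x∉clA x∈clAG)
    where
    keep-f : ∃[ G′ ] (length G ≡ suc (length G′) ×
                      A ∪ (_∈ₗ G) ⊆ cl Indep ((A ∪ ｛ x ｝) ∪ (_∈ₗ G′))) →
             ∃[ F′ ] (length (f ∷ G) ≡ suc (length F′) ×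
                      A ∪ (_∈ₗ f ∷ G) ⊆ cl Indep ((A ∪ ｛ x ｝) ∪ (_∈ₗ F′)))
    keep-f (G′ , |G|≡ , spans) = f ∷ G′ , cong suc |G|≡ , spans′
      where
      spans′ : A ∪ (_∈ₗ f ∷ G) ⊆ cl Indep ((A ∪ ｛ x ｝) ∪ (_∈ₗ f ∷ G′))
      spans′ (inj₁ Az) = inj₁ (inj₁ (inj₁ Az))
      spans′ (inj₂ (here z≡f)) = inj₁ (inj₂ (here z≡f))
      spans′ (inj₂ (there z∈G)) =
        cl-mono (λ { (inj₁ a) → inj₁ a ; (inj₂ p) → inj₂ (there p) }) (spans (inj₂ z∈G))
  ... | no x∉clAG = G , refl , spans
    where
    reassociate : ∀ {B : Subset E} {z} → (A ∪ B) ∪ ｛ z ｝ ⊆ (A ∪ ｛ z ｝) ∪ B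
    reassociate (inj₁ (inj₁ a)) = inj₁ (inj₁ a)
    reassociate (inj₁ (inj₂ b)) = inj₂ b
    reassociate (inj₂ z≡) = inj₁ (inj₂ z≡)
    x∈clAGf : cl Indep ((A ∪ (_∈ₗ G)) ∪ ｛ f ｝) x
    x∈clAGf = cl-mono (λ { (inj₁ a) → inj₁ (inj₁ a)
                         ; (inj₂ (here z≡f)) → inj₂ (sym z≡f)
                         ; (inj₂ (there p)) → inj₁ (inj₂ p) }) x∈cl
    spans : A ∪ (_∈ₗ f ∷ G) ⊆ cl Indep ((A ∪ ｛ x ｝) ∪ (_∈ₗ G))
    spans (inj₁ Az) = inj₁ (inj₁ (inj₁ Az))
    spans (inj₂ (here refl)) = cl-mono (reassociate {B = _∈ₗ G}) (cl-exchange x∈clAGf x∉clAG)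
    spans (inj₂ (there z∈G)) = inj₁ (inj₂ z∈G)

  independent-length-≤ : ∀ {Q} xs F → Indep Q → A ⊆ Q → Q ⊆ cl Indep (A ∪ (_∈ₗ F)) →
                         Unique xs → All (Q － A) xs → length xs ≤ℕ length F
  independent-length-≤ [] F _ _ _ _ _ = z≤n
  independent-length-≤ {A} {Q} (x ∷ xs) F iQ A⊆Q Q⊆cl (x∉xs ∷ uxs) ((Qx , ¬Ax) ∷ rest)
    with exchange-into-list F x∉clA (Q⊆cl Qx)
    where
    x∉clA : ¬ cl Indep A x
    x∉clA x∈clA = ∈cl⇒dependent ¬Ax x∈clA (Indep-⊆ (insert-⊆ A⊆Q Qx) iQ)
  ... | F′ , |F|≡ , spans = subst (suc (length xs) ≤ℕ_) (sym |F|≡) (s≤s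
    (independent-length-≤ xs F′ iQ (insert-⊆ A⊆Q Qx) (λ Qz → cl-⊆-cl spans (Q⊆cl Qz)) uxs
      (All.zipWith (λ { (x≢z , Qz , ¬Az) → Qz , λ { (inj₁ Az) → ¬Az Az ; (inj₂ x≡z) → x≢z x≡z } })
                   (x∉xs , rest))))

  contract-basis-spans : BasisOf (contract Indep X) (Y － X) B → BasisOf Indep X J → Indep (B ∪ J) →
                         Y ⊆ cl Indep (B ∪ J)
  contract-basis-spans {X} {Y} {B} {J} ((_ , B⊆Y-X) , maximal) basisJ iBJ {y} Yy with decide (X y) | decide (B y)
  ... | yes Xy | _ = cl-mono inj₂ (basis-spans basisJ Xy)
  ... | no _ | yes By = inj₁ (inj₁ By)
  ... | no ¬Xy | no ¬By = dependent⇒∈cl iBJ λ iBJy →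
    ¬By (maximal (B ∪ ｛ y ｝) ((insert-⊆ (λ b → proj₂ (B⊆Y-X b)) ¬Xy , J , basisJ , Indep-⊆ B∪y∪J⊆ iBJy) ,
                                insert-⊆ B⊆Y-X (Yy , ¬Xy)) inj₁ (inj₂ refl))
    where
    B∪y∪J⊆ : (B ∪ ｛ y ｝) ∪ J ⊆ (B ∪ J) ∪ ｛ y ｝
    B∪y∪J⊆ (inj₁ (inj₁ b)) = inj₁ (inj₁ b)
    B∪y∪J⊆ (inj₁ (inj₂ y≡z)) = inj₂ y≡z
    B∪y∪J⊆ (inj₂ j) = inj₁ (inj₂ j)

  contract-rank-∈cl : cl Indep X e → HasRank (contract Indep X) ((X ∪ ｛ e ｝) － X) (fin 0)
  contract-rank-∈cl {X} {e} e∈clX with basis-exists X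
  ... | J , basisJ@((iJ , _) , _) =
    ∅ , ((((λ {_} ()) , J , basisJ , Indep-⊆ (λ { (inj₂ Jz) → Jz }) iJ) , (λ {_} ())) , maximal) , size-∅
    where
    maximal : ∀ K → contract Indep X K × K ⊆ (X ∪ ｛ e ｝) － X → ∅ ⊆ K → K ⊆ ∅
    maximal K ((_ , J′ , basisJ′@((_ , J′⊆X) , _) , iKJ′) , K⊆) _ Kz with K⊆ Kz
    ... | inj₁ Xz , ¬Xz = ¬Xz Xz
    ... | inj₂ refl , ¬Xe =
      ∈cl⇒dependent (λ J′e → ¬Xe (J′⊆X J′e)) (basis-cl basisJ′ e∈clX)
                    (Indep-⊆ (insert-⊆ {A = J′} inj₂ (inj₁ Kz)) iKJ′)

  contract-rank-∉cl : ¬ cl Indep X e → HasRank (contract Indep X) ((X ∪ ｛ e ｝) － X) (fin 1)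
  contract-rank-∉cl {X} {e} e∉clX with basis-exists X
  ... | J , basisJ@((iJ , J⊆X) , _) =
    ｛ e ｝ ,
    ((((λ { refl → ¬Xe }) , J , basisJ , Indep-⊆ e∪J⊆ iJe) , (λ { refl → inj₂ refl , ¬Xe })) , maximal) ,
    size-｛｝
    where
    ¬Xe : ¬ X e
    ¬Xe Xe = e∉clX (inj₁ Xe)
    iJe : Indep (J ∪ ｛ e ｝)
    iJe = ∉cl⇒independent iJ (λ e∈clJ → e∉clX (cl-mono J⊆X e∈clJ))
    e∪J⊆ : ｛ e ｝ ∪ J ⊆ J ∪ ｛ e ｝
    e∪J⊆ (inj₁ e≡z) = inj₂ e≡z
    e∪J⊆ (inj₂ Jz) = inj₁ Jz
    maximal : ∀ K → contract Indep X K × K ⊆ (X ∪ ｛ e ｝) － X → ｛ e ｝ ⊆ K → K ⊆ ｛ e ｝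
    maximal K (_ , K⊆) _ Kz with K⊆ Kz
    ... | inj₁ Xz , ¬Xz = ⊥-elim (¬Xz Xz)
    ... | inj₂ e≡z , _ = e≡z

  base-exchange : Base Indep B → ¬ B y → Indep ((B － ｛ e ｝) ∪ ｛ y ｝) → Base Indep ((B － ｛ e ｝) ∪ ｛ y ｝)
  base-exchange {B} {y} {e} baseB ¬By iB′ = ¬¬-elim λ ¬baseB′ → extend (I3 B′ B iB′ ¬baseB′ baseB)
    where
    B′ : Subset E
    B′ = (B － ｛ e ｝) ∪ ｛ y ｝
    extend : ∃[ w ] (B w × ¬ B′ w × Indep (B′ ∪ ｛ w ｝)) → ⊥
    extend (w , Bw , ¬B′w , iB′w) with decide (e ≡ w)
    ... | no e≢w = ¬B′w (inj₁ (Bw , e≢w))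
    ... | yes refl = base-maximal baseB ¬By (Indep-⊆ B∪y⊆ iB′w)
      where
      B∪y⊆ : B ∪ ｛ y ｝ ⊆ B′ ∪ ｛ e ｝
      B∪y⊆ (inj₂ refl) = inj₁ (inj₂ refl)
      B∪y⊆ {z} (inj₁ Bz) with decide (e ≡ z)
      ... | yes e≡z = inj₂ e≡z
      ... | no e≢z = inj₁ (inj₁ (Bz , e≢z))

  fundamental-cocircuit : Subset E → E → Subset E
  fundamental-cocircuit B e = ｛ e ｝ ∪ λ z → ¬ B z × Small (Indep ((B － ｛ e ｝) ∪ ｛ z ｝))

  fundamental-cocircuit-circuit : Base Indep B → B e → Circuit (dual Indep) (fundamental-cocircuit B e)
  fundamental-cocircuit-circuit {B} {e} baseB@(iB , maximalB) Be = dependent , minimal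
    where
    D = fundamental-cocircuit B e
    iB-e : Indep (B － ｛ e ｝)
    iB-e = Indep-⊆ proj₁ iB
    dependent : ¬ dual Indep D
    dependent (B′ , baseB′ , D⊆∁B′) with I3 (B － ｛ e ｝) B′ iB-e ¬baseB-e baseB′
      where
      ¬baseB-e : ¬ Base Indep (B － ｛ e ｝)
      ¬baseB-e (_ , maximal) = proj₂ (maximal B iB proj₁ Be) refl
    ... | x , B′x , x∉B-e , iB-e+x with decide (e ≡ x) | decide (B x)
    ...   | yes refl | _ = D⊆∁B′ (inj₁ refl) B′x
    ...   | no e≢x | yes Bx = x∉B-e (Bx , e≢x)
    ...   | no _ | no ¬Bx = D⊆∁B′ (inj₂ (¬Bx , small iB-e+x)) B′x
    minimal : ∀ D′ → D′ ⊊ D → dual Indep D′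
    minimal D′ (D′⊆D , D⊈D′) with ¬⊆⇒∃∉ D⊈D′
    ... | y , inj₁ refl , ¬D′e = B , baseB , D′⊆∁B
      where
      D′⊆∁B : D′ ⊆ ∁ B
      D′⊆∁B D′z with D′⊆D D′z
      ... | inj₁ refl = ⊥-elim (¬D′e D′z)
      ... | inj₂ (¬Bz , _) = ¬Bz
    ... | y , inj₂ (¬By , iB-e+y) , ¬D′y =
      (B － ｛ e ｝) ∪ ｛ y ｝ , base-exchange baseB ¬By (unsmall iB-e+y) , D′⊆∁B-e+y
      where
      D′⊆∁B-e+y : D′ ⊆ ∁ ((B － ｛ e ｝) ∪ ｛ y ｝)
      D′⊆∁B-e+y D′z (inj₂ refl) = ¬D′y D′z
      D′⊆∁B-e+y D′z (inj₁ (Bz , e≢z)) with D′⊆D D′z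
      ... | inj₁ e≡z = e≢z e≡z
      ... | inj₂ (¬Bz , _) = ¬Bz Bz

  ∉cl⇒∈cl-dual : ¬ cl Indep (∁ (X ∪ ｛ e ｝)) e → cl (dual Indep) X e
  ∉cl⇒∈cl-dual {X} {e} e∉cl with basis-exists (∁ (X ∪ ｛ e ｝))
  ... | I , basisI@((iI , I⊆Y) , _) with base-⊇ (∉cl⇒independent iI (λ e∈clI → e∉cl (cl-mono I⊆Y e∈clI)))
  ... | B , baseB , I∪e⊆B =
    inj₂ (fundamental-cocircuit B e , fundamental-cocircuit-circuit baseB (I∪e⊆B (inj₂ refl)) , inj₁ refl , D⊆)
    where
    I⊆B-e : I ⊆ B － ｛ e ｝
    I⊆B-e Iz = I∪e⊆B (inj₁ Iz) , λ { refl → I⊆Y Iz (inj₂ refl) }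
    D⊆ : fundamental-cocircuit B e ⊆ X ∪ ｛ e ｝
    D⊆ (inj₁ e≡z) = inj₂ e≡z
    D⊆ (inj₂ (¬Bz , iB-e+z)) = ¬¬-elim λ z∉X∪e →
      basis-maximal basisI z∉X∪e (λ Iz → ¬Bz (I∪e⊆B (inj₁ Iz))) (Indep-⊆ (insert-mono {A = I} I⊆B-e) (unsmall iB-e+z))

  circuit-cocircuit-orthogonal : {C D : Subset E} → Circuit Indep C → Circuit (dual Indep) D →
                                 C e → D e → ¬ C ∩ D ⊆ ｛ e ｝
  circuit-cocircuit-orthogonal {e} {C} {D} (¬iC , minimalC) (¬dualD , minimalD) Ce De C∩D⊆e
    with minimalD (D － ｛ e ｝) (proj₁ , λ D⊆D-e → proj₂ (D⊆D-e De) refl)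
       | basis-⊇ {X = ∁ D} (minimalC (C － ｛ e ｝) (proj₁ , λ C⊆C-e → proj₂ (C⊆C-e Ce) refl)) C-e⊆∁D
    where
    C-e⊆∁D : C － ｛ e ｝ ⊆ ∁ D
    C-e⊆∁D (Cz , e≢z) Dz = e≢z (C∩D⊆e (Cz , Dz))
  ... | B , baseB , D-e⊆∁B | K , basisK@((iK , K⊆∁D) , _) , C-e⊆K = ¬dualD (K , baseK , λ Dz Kz → K⊆∁D Kz Dz)
    where
    C⊆K∪e : C ⊆ K ∪ ｛ e ｝
    C⊆K∪e {z} Cz with decide (e ≡ z)
    ... | yes e≡z = inj₂ e≡z
    ... | no e≢z = inj₁ (C-e⊆K (Cz , e≢z))
    baseK : Base Indep K
    baseK = ¬¬-elim λ ¬baseK → extend (I3 K B iK ¬baseK baseB)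
      where
      extend : ∃[ x ] (B x × ¬ K x × Indep (K ∪ ｛ x ｝)) → ⊥
      extend (x , Bx , ¬Kx , iKx) with decide (D x) | decide (e ≡ x)
      ... | no ¬Dx | _ = basis-maximal basisK ¬Dx ¬Kx iKx
      ... | yes Dx | no e≢x = D-e⊆∁B (Dx , e≢x) Bx
      ... | yes _ | yes refl = ¬iC (Indep-⊆ C⊆K∪e iKx)

  ∈cl-dual⇒∉cl : ¬ X e → cl (dual Indep) X e → ¬ cl Indep (∁ (X ∪ ｛ e ｝)) e
  ∈cl-dual⇒∉cl ¬Xe (inj₁ Xe) _ = ¬Xe Xe
  ∈cl-dual⇒∉cl ¬Xe (inj₂ _) (inj₁ e∉X∪e) = e∉X∪e (inj₂ refl)
  ∈cl-dual⇒∉cl {X} {e} ¬Xe (inj₂ (D , cocircuitD , De , D⊆)) (inj₂ (C , circuitC , Ce , C⊆)) =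
    circuit-cocircuit-orthogonal circuitC cocircuitD Ce De C∩D⊆e
    where
    C∩D⊆e : C ∩ D ⊆ ｛ e ｝
    C∩D⊆e (Cz , Dz) with C⊆ Cz | D⊆ Dz
    ... | inj₂ e≡z | _ = e≡z
    ... | inj₁ _ | inj₂ e≡z = e≡z
    ... | inj₁ z∉X∪e | inj₁ Xz = ⊥-elim (z∉X∪e (inj₁ Xz))

  cl-dual : ¬ X e → cl (dual Indep) X e ⇔ (¬ cl Indep (∁ (X ∪ ｛ e ｝)) e)
  cl-dual ¬Xe = mk⇔ (∈cl-dual⇒∉cl ¬Xe) ∉cl⇒∈cl-dual

module Quotient (em : ∀ {ℓ} → ExcludedMiddle ℓ) {E : Set} (M N : Matroid E) where
  open Classical em
  private
    module M = MatroidProperties em M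
    module N = MatroidProperties em N

  ≼⇒dual-≽ : Ind N ≼ Ind M → dual (Ind M) ≼ dual (Ind N)
  ≼⇒dual-≽ N≼M X {e} e∈cl*N with decide (X e)
  ... | yes Xe = inj₁ Xe
  ... | no ¬Xe = Equivalence.from (M.cl-dual ¬Xe) λ e∈clM → Equivalence.to (N.cl-dual ¬Xe) e∈cl*N (N≼M _ e∈clM)

  dual-≽⇒≼ : dual (Ind M) ≼ dual (Ind N) → Ind N ≼ Ind M
  dual-≽⇒≼ M*≼N* X {e} e∈clM with decide (X e)
  ... | yes Xe = inj₁ Xe
  ... | no ¬Xe = N.cl-mono (proj₂ (∁-∁-insert ¬Xe)) (¬¬-elim λ e∉clN →
                   M.∈cl-dual⇒∉cl ¬X′e (M*≼N* X′ (N.∉cl⇒∈cl-dual e∉clN))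
                     (M.cl-mono (proj₁ (∁-∁-insert ¬Xe)) e∈clM))
    where
    X′ : Subset E
    X′ = ∁ (X ∪ ｛ e ｝)
    ¬X′e : ¬ X′ e
    ¬X′e e∉X∪e = e∉X∪e (inj₂ refl)

  independent-cl-⊆⇒≼ : (∀ I → Ind M I → cl (Ind M) I ⊆ cl (Ind N) I) → Ind N ≼ Ind M
  independent-cl-⊆⇒≼ cl-⊆ X e∈clMX with M.basis-exists X
  ... | I , basisI@((iI , I⊆X) , _) = N.cl-mono I⊆X (cl-⊆ I iI (M.basis-cl basisI e∈clMX))

  ≼⇒flat : Ind N ≼ Ind M → ∀ F → Flat (Ind N) F → Flat (Ind M) F
  ≼⇒flat N≼M F flatF e∈clMF = flatF (N≼M F e∈clMF)

  flat⇒≼ : (∀ F → Flat (Ind N) F → Flat (Ind M) F) → Ind N ≼ Ind M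
  flat⇒≼ flat X e∈clMX with N.basis-exists X
  ... | I , basisI@((_ , I⊆X) , _) =
    N.cl-mono I⊆X (unsmall (flat (N.clˢ I) N.clˢ-flat (M.cl-mono (λ Xz → small (N.basis-spans basisI Xz)) e∈clMX)))

  ≼⇒circuit-union : Ind N ≼ Ind M → ∀ C → Circuit (Ind M) C →
                    ∃[ 𝒟 ] ((∀ D → 𝒟 D → Circuit (Ind N) D) × C ≐ ⋃ 𝒟)
  ≼⇒circuit-union N≼M C circuitC = 𝒟 , (λ _ → proj₁) , C⊆⋃𝒟 , ⋃𝒟⊆C
    where
    𝒟 : Subset E → Set₁
    𝒟 D = Circuit (Ind N) D × D ⊆ C
    C⊆⋃𝒟 : C ⊆ ⋃ 𝒟
    C⊆⋃𝒟 {e} Ce with N≼M (C － ｛ e ｝) (inj₂ (C , circuitC , Ce , C⊆C-e+e))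
      where
      C⊆C-e+e : C ⊆ (C － ｛ e ｝) ∪ ｛ e ｝
      C⊆C-e+e {z} Cz with decide (e ≡ z)
      ... | yes e≡z = inj₂ e≡z
      ... | no e≢z = inj₁ (Cz , e≢z)
    ... | inj₁ (_ , e≢e) = ⊥-elim (e≢e refl)
    ... | inj₂ (D , circuitD , De , D⊆) = D , (circuitD , D⊆C) , De
      where
      D⊆C : D ⊆ C
      D⊆C Dz with D⊆ Dz
      ... | inj₁ (Cz , _) = Cz
      ... | inj₂ refl = Ce
    ⋃𝒟⊆C : ⋃ 𝒟 ⊆ C
    ⋃𝒟⊆C (_ , (_ , D⊆C) , Dz) = D⊆C Dz

  circuit-union⇒≼ : (∀ C → Circuit (Ind M) C → ∃[ 𝒟 ] ((∀ D → 𝒟 D → Circuit (Ind N) D) × C ≐ ⋃ 𝒟)) →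
                    Ind N ≼ Ind M
  circuit-union⇒≼ _ X (inj₁ Xe) = inj₁ Xe
  circuit-union⇒≼ union X (inj₂ (C , circuitC , Ce , C⊆)) with union C circuitC
  ... | 𝒟 , circuits , C⊆⋃ , ⋃⊆C with C⊆⋃ Ce
  ...   | D , 𝒟D , De = inj₂ (D , circuits D 𝒟D , De , λ Dz → C⊆ (⋃⊆C (D , 𝒟D , Dz)))

  ≼⇒contract-rank-≤ : Ind N ≼ Ind M → ∀ X Y → X ⊆ Y → ∀ k l →
                      HasRank (contract (Ind N) X) (Y － X) k → HasRank (contract (Ind M) X) (Y － X) l → k ≤∞ l
  ≼⇒contract-rank-≤ _ X Y _ k ∞ _ _ = k ≤∞∞
  ≼⇒contract-rank-≤ N≼M X Y X⊆Y k (fin n)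
    (BN , (((BN⊆∁X , JN , basisJN@((_ , JN⊆X) , _) , iBN∪JN) , BN⊆Y-X) , _) , sizeBN)
    (BM , basisBM@(((_ , JM , basisJM@((_ , JM⊆X) , _) , iBM∪JM) , _) , _) , ys , _ , |ys|≡n , BM⇔ys)
    = size-≤-fin sizeBN bound
    where
    BM∪JM⊆clN : BM ∪ JM ⊆ cl (Ind N) (JN ∪ (_∈ₗ ys))
    BM∪JM⊆clN (inj₁ BMz) = inj₁ (inj₂ (Equivalence.to (BM⇔ys _) BMz))
    BM∪JM⊆clN (inj₂ JMz) = N.cl-mono inj₁ (N.basis-spans basisJN (JM⊆X JMz))
    BN∪JN⊆clN : BN ∪ JN ⊆ cl (Ind N) (JN ∪ (_∈ₗ ys))
    BN∪JN⊆clN Qz = N.cl-⊆-cl BM∪JM⊆clN (N≼M _ (M.contract-basis-spans basisBM basisJM iBM∪JM (BN∪JN⊆Y Qz)))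
      where
      BN∪JN⊆Y : BN ∪ JN ⊆ Y
      BN∪JN⊆Y (inj₁ BNz) = proj₁ (BN⊆Y-X BNz)
      BN∪JN⊆Y (inj₂ JNz) = X⊆Y (JN⊆X JNz)
    bound : ∀ xs → Unique xs → All BN xs → length xs ≤ℕ n
    bound xs uxs BNxs = subst (length xs ≤ℕ_) |ys|≡n
      (N.independent-length-≤ xs ys iBN∪JN inj₂ BN∪JN⊆clN uxs
        (All.map (λ BNz → inj₁ BNz , λ JNz → BN⊆∁X BNz (JN⊆X JNz)) BNxs))

  contract-rank-≤⇒≼ : (∀ X Y → X ⊆ Y → ∀ k l →
                        HasRank (contract (Ind N) X) (Y － X) k → HasRank (contract (Ind M) X) (Y － X) l → k ≤∞ l) →
                      Ind N ≼ Ind M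
  contract-rank-≤⇒≼ rank-≤ X {e} e∈clM = ¬¬-elim λ e∉clN →
    1≰0 (rank-≤ X (X ∪ ｛ e ｝) inj₁ (fin 1) (fin 0) (N.contract-rank-∉cl e∉clN) (M.contract-rank-∈cl e∈clM))
    where
    1≰0 : ¬ fin 1 ≤∞ fin 0
    1≰0 (fin≤fin ())

mainTheorem4 : (em : ∀ {ℓ : Level} → ExcludedMiddle ℓ) →
  {E : Set} (M N : Matroid E) →
  let P1 = Ind N ≼ Ind M
      P2 = dual (Ind M) ≼ dual (Ind N)
      P3 = ∀ X → cl (Ind M) X ⊆ cl (Ind N) X
      P4 = ∀ I → Ind M I → cl (Ind M) I ⊆ cl (Ind N) I
      P5 = ∀ F → Flat (Ind N) F → Flat (Ind M) F
      P6 = ∀ C → Circuit (Ind M) C →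
             Data.Product.∃ (λ 𝒟 → (∀ D → 𝒟 D → Circuit (Ind N) D) × (C ≐ ⋃ 𝒟))
      P7 = ∀ X Y → X ⊆ Y → ∀ k l →
             HasRank (contract (Ind N) X) (Y － X) k →
             HasRank (contract (Ind M) X) (Y － X) l → k ≤∞ l
  in (P1 ⇔ P2) × (P1 ⇔ P3) × (P1 ⇔ P4) × (P1 ⇔ P5) × (P1 ⇔ P6) × (P1 ⇔ P7)
mainTheorem4 em M N =
  mk⇔ ≼⇒dual-≽ dual-≽⇒≼ ,
  mk⇔ id id ,
  mk⇔ (λ N≼M I _ → N≼M I) independent-cl-⊆⇒≼ ,
  mk⇔ ≼⇒flat flat⇒≼ ,
  mk⇔ ≼⇒circuit-union circuit-union⇒≼ ,
  mk⇔ ≼⇒contract-rank-≤ contract-rank-≤⇒≼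
  where
  open Quotient em M N
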